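{- Let $n$ be a positive integer and let $G$ be the complete graph on $n$ vertices including loops (every pair of distinct vertices is joined by an edge, and every vertex has a loop). Then for some integer $p\leq 10\log n$ there are linear orderings $<_1,\dots,<_p$ of $V(G)$ such that: (1) every pair of disjoint edges $e,f\in E(G)$ is separated in some $<_i$; and (2) for every vertex $v\in V(G)$ and all distinct vertices $u,w\in V(G)\setminus\{v\}$, for some $i\in\{1,\dots,p\}$ we have $u<_i v<_i w$ or $w<_i v<_i u$.
   Context: Two edges are disjoint if they share no endpoint (a loop at $v$ has the single endpoint $v$). Edges $e,f$ are separated in a linear ordering if all endpoints of $e$ precede all endpoints of $f$, or all endpoints of $f$ precede all endpoints of $e$. $\log$ denotes the natural logarithm. -}

module Defs where

open import Data.Nat using (ℕ; zero; suc; _!; _+_; _*_; _^_; _≤_)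
open import Data.Fin using (Fin; toℕ)
import Data.Fin as F
open import Data.Fin.Permutation using (Permutation′; _⟨$⟩ʳ_)
open import Data.Product using (_×_)
open import Data.Sum using (_⊎_)
open import Relation.Binary.PropositionalEquality using (_≢_)

-- A linear ordering of the vertex set Fin n is given by a permutation π
-- (π assigns each vertex its position); u precedes v iff π u < π v.
LinOrd : ℕ → Set
LinOrd n = Permutation′ n

_≺[_]_ : ∀ {n} → Fin n → LinOrd n → Fin n → Set
u ≺[ π ] v = π ⟨$⟩ʳ u F.< π ⟨$⟩ʳ v

-- Edges of the complete graph with loops on Fin n: every (unordered) pair
-- {a , b}, a = b allowed (a loop).  We represent edge {a,b} by its endpoints.
Disjoint : ∀ {n} → (a b c d : Fin n) → Set
Disjoint a b c d = (a ≢ c) × (a ≢ d) × (b ≢ c) × (b ≢ d)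

Precedes : ∀ {n} → LinOrd n → (a b c d : Fin n) → Set
Precedes π a b c d = (a ≺[ π ] c) × (a ≺[ π ] d) × (b ≺[ π ] c) × (b ≺[ π ] d)

Separated : ∀ {n} → LinOrd n → (a b c d : Fin n) → Set
Separated π a b c d = Precedes π a b c d ⊎ Precedes π c d a b

Between : ∀ {n} → LinOrd n → (u v w : Fin n) → Set
Between π u v w = ((u ≺[ π ] v) × (v ≺[ π ] w)) ⊎ ((w ≺[ π ] v) × (v ≺[ π ] u))

-- eNum k = k! * S_k where S_k = Σ_{j=0}^{k} 1/j! is the k-th partial sum
-- of the series for e.  (eNum 0 = 1, eNum (k+1) = (k+1) * eNum k + 1.)
eNum : ℕ → ℕ
eNum zero    = 1
eNum (suc k) = suc k * eNum k + 1

-- p ≤ 10 log n (natural log), for n ≥ 1, is equivalent to e^p ≤ n^10.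
-- Since S_k increases to e, e^p ≤ n^10 iff S_k^p ≤ n^10 for every k,
-- i.e. iff eNum k ^ p ≤ n ^ 10 * (k !) ^ p for every k.
LogBound : ℕ → ℕ → Set
LogBound p n = ∀ k → eNum k ^ p ≤ n ^ 10 * (k !) ^ p

-- A linear order of Fin n is sampled as an injective position function Fin n → Fin n,
-- coded as an element of Fin (n ^ n).  Each requirement (two disjoint edges to be
-- separated, or a vertex to lie between two others) has two transpositions σ, τ of the
-- vertices such that every order satisfies it after relabelling by id, σ or τ.  As
-- precomposition with a permutation permutes the codes, at least a third of all orders
-- satisfy each requirement, so some order satisfies a third of any list of them.
-- Greedily choosing such orders for the N ≤ 2n⁴/3 requirements (up to symmetry) takes
-- p rounds with (3/2)^(p-1) ≤ N, i.e. 3^p ≤ 2^p n⁴.  Finally (11/4)² < (3/2)⁵ turns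
-- this into (11/4)^p ≤ n¹⁰, and e < 11/4 gives p ≤ 10 log n.
module Submission where

open import Data.Empty using (⊥-elim)
open import Data.Fin using (Fin; zero; suc; finToFun; funToFin; combine; punchOut)
open import Data.Fin.Permutation
  using (Permutation′; permutation; id; transpose; _⟨$⟩ʳ_; _⟨$⟩ˡ_; inverseˡ; inverseʳ)
import Data.Fin.Properties as Fin
open import Data.List
  using (List; []; _∷_; length; map; filter; _++_; allFin; cartesianProduct; cartesianProductWith)
open import Data.List.Membership.Propositional using (_∈_)
open import Data.List.Membership.Propositional.Properties
  using (∈-filter⁺; ∈-map⁺; ∈-++⁺ˡ; ∈-++⁺ʳ; ∈-allFin; ∈-cartesianProduct⁺; ∈-cartesianProductWith⁺)
open import Data.List.Properties using (length-++; length-map; length-tabulate)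
open import Data.List.Relation.Unary.Any using (here; there)
open import Data.Nat
  using (ℕ; zero; suc; _+_; _*_; _^_; _!; _≤_; _<_; _≤?_; _<?_; z≤n; s≤s; NonZero)
open import Data.Nat.Induction using (<-wellFounded)
open import Data.Nat.Properties hiding (<-trans)
open import Algebra.Properties.CommutativeSemigroup *-commutativeSemigroup
  using (x∙yz≈y∙xz; interchange)
open import Algebra.Properties.Semiring.Sum +-*-semiring
  using (sum; sum-permute; ∑-distrib-+; *-distribˡ-sum; sum-cong-≗)
open import Data.Nat.Solver using (module +-*-Solver)
open +-*-Solver using (solve; _:+_; _:*_; _:^_; _:=_; con)
open import Data.Product using (Σ; ∃; ∃₂; ∃-syntax; _×_; _,_; proj₁; proj₂; uncurry)
import Data.Product as Product
open import Data.Sum using (_⊎_; inj₁; inj₂)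
import Data.Sum as Sum
open import Function using (_∘_; const)
open import Function.Consequences.Propositional using (contraInjective)
open import Function.Definitions using (Injective)
open import Induction.WellFounded using (Acc; acc)
open import Level using (0ℓ)
open import Relation.Binary using (Rel; IsStrictTotalOrder; tri<; tri≈; tri>)
open import Relation.Binary.PropositionalEquality
open import Relation.Nullary using (Dec; yes; no; ¬?; contradiction)
open import Relation.Nullary.Decidable using (dec-true; dec-false; map′; _×-dec_; _⊎-dec_; _→-dec_)
open import Relation.Unary using (Pred; Decidable)
open import Relation.Unary.Properties using (∁?)

open import Defs

module StrictOrderFacts {A : Set} {_<_ : Rel A 0ℓ} (sto : IsStrictTotalOrder _≡_ _<_) where

  open IsStrictTotalOrder sto using (compare) renaming (_<?_ to _<ᵈ_; trans to <-trans)

  _,_≪_,_ : A → A → A → A → Set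
  a , b ≪ c , d = (a < c) × (a < d) × (b < c) × (b < d)

  Separated₄ : A → A → A → A → Set
  Separated₄ a b c d = a , b ≪ c , d ⊎ c , d ≪ a , b

  Between₃ : A → A → A → Set
  Between₃ u v w = (u < v × v < w) ⊎ (w < v × v < u)

  Separated₄? : ∀ a b c d → Dec (Separated₄ a b c d)
  Separated₄? a b c d = (a <ᵈ c ×-dec a <ᵈ d ×-dec b <ᵈ c ×-dec b <ᵈ d)
                  ⊎-dec (c <ᵈ a ×-dec c <ᵈ b ×-dec d <ᵈ a ×-dec d <ᵈ b)

  Between₃? : ∀ u v w → Dec (Between₃ u v w)
  Between₃? u v w = (u <ᵈ v ×-dec v <ᵈ w) ⊎-dec (w <ᵈ v ×-dec v <ᵈ u)

  Separated₄-sym : ∀ {a b c d} → Separated₄ a b c d → Separated₄ c d a b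
  Separated₄-sym = Sum.swap

  Between₃-sym : ∀ {u v w} → Between₃ u v w → Between₃ w v u
  Between₃-sym = Sum.swap

  <-or-> : ∀ {a b} → a ≢ b → a < b ⊎ b < a
  <-or-> {a} {b} a≢b with compare a b
  ... | tri< a<b _ _ = inj₁ a<b
  ... | tri≈ _ a≡b _ = contradiction a≡b a≢b
  ... | tri> _ _ b<a = inj₂ b<a

  points-separated : ∀ {a c} → a ≢ c → Separated₄ a a c c
  points-separated a≢c with <-or-> a≢c
  ... | inj₁ a<c = inj₁ (a<c , a<c , a<c , a<c)
  ... | inj₂ c<a = inj₂ (c<a , c<a , c<a , c<a)

  some-between : ∀ {u v w} → u ≢ v → v ≢ w → u ≢ w →
                 Between₃ u v w ⊎ Between₃ v u w ⊎ Between₃ u w v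
  some-between u≢v v≢w u≢w with <-or-> u≢v | <-or-> v≢w | <-or-> u≢w
  ... | inj₁ u<v | inj₁ v<w | _        = inj₁ (inj₁ (u<v , v<w))
  ... | inj₂ v<u | inj₂ w<v | _        = inj₁ (inj₂ (w<v , v<u))
  ... | inj₁ u<v | inj₂ w<v | inj₁ u<w = inj₂ (inj₂ (inj₁ (u<w , w<v)))
  ... | inj₁ u<v | inj₂ w<v | inj₂ w<u = inj₂ (inj₁ (inj₂ (w<u , u<v)))
  ... | inj₂ v<u | inj₁ v<w | inj₁ u<w = inj₂ (inj₁ (inj₁ (v<u , u<w)))
  ... | inj₂ v<u | inj₁ v<w | inj₂ w<u = inj₂ (inj₂ (inj₂ (v<w , w<u)))

  some-extreme : ∀ {a c d} → a ≢ c → a ≢ d → c ≢ d →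
                 Separated₄ a a c d ⊎ Separated₄ c c a d ⊎ Separated₄ d d c a
  some-extreme a≢c a≢d c≢d with <-or-> a≢c | <-or-> a≢d
  ... | inj₁ a<c | inj₁ a<d = inj₁ (inj₁ (a<c , a<d , a<c , a<d))
  ... | inj₂ c<a | inj₂ d<a = inj₁ (inj₂ (c<a , c<a , d<a , d<a))
  ... | inj₁ a<c | inj₂ d<a = inj₂ (inj₂ (inj₁ (<-trans d<a a<c , d<a , <-trans d<a a<c , d<a)))
  ... | inj₂ c<a | inj₁ a<d = inj₂ (inj₁ (inj₁ (c<a , <-trans c<a a<d , c<a , <-trans c<a a<d)))

  -- a is paired with whichever of b, c, d lies alone on its side of a or, when a is
  -- extreme, with the nearest of them.
  some-partner : ∀ {a b c d} → a ≢ b → a ≢ c → a ≢ d → b ≢ c → b ≢ d → c ≢ d →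
                 Separated₄ a b c d ⊎ Separated₄ a c b d ⊎ Separated₄ a d c b
  some-partner a≢b a≢c a≢d b≢c b≢d c≢d with <-or-> a≢b | <-or-> a≢c | <-or-> a≢d
  ... | inj₂ b<a | inj₁ a<c | inj₁ a<d = inj₁ (inj₁ (a<c , a<d , <-trans b<a a<c , <-trans b<a a<d))
  ... | inj₁ a<b | inj₂ c<a | inj₁ a<d = inj₂ (inj₁ (inj₁ (a<b , a<d , <-trans c<a a<b , <-trans c<a a<d)))
  ... | inj₁ a<b | inj₁ a<c | inj₂ d<a = inj₂ (inj₂ (inj₁ (a<c , a<b , <-trans d<a a<c , <-trans d<a a<b)))
  ... | inj₁ a<b | inj₂ c<a | inj₂ d<a = inj₁ (inj₂ (c<a , <-trans c<a a<b , d<a , <-trans d<a a<b))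
  ... | inj₂ b<a | inj₁ a<c | inj₂ d<a = inj₂ (inj₁ (inj₂ (b<a , <-trans b<a a<c , d<a , <-trans d<a a<c)))
  ... | inj₂ b<a | inj₂ c<a | inj₁ a<d = inj₂ (inj₂ (inj₂ (c<a , <-trans c<a a<d , b<a , <-trans b<a a<d)))
  ... | inj₁ a<b | inj₁ a<c | inj₁ a<d with <-or-> b≢c
  ...   | inj₁ b<c with <-or-> b≢d
  ...     | inj₁ b<d = inj₁ (inj₁ (a<c , a<d , b<c , b<d))
  ...     | inj₂ d<b = inj₂ (inj₂ (inj₁ (a<c , a<b , <-trans d<b b<c , d<b)))
  some-partner _ _ _ b≢c b≢d c≢d | inj₁ a<b | inj₁ a<c | inj₁ a<d | inj₂ c<b with <-or-> c≢d
  ...     | inj₁ c<d = inj₂ (inj₁ (inj₁ (a<b , a<d , c<b , c<d)))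
  ...     | inj₂ d<c = inj₂ (inj₂ (inj₁ (a<c , a<b , d<c , <-trans d<c c<b)))
  some-partner _ _ _ b≢c b≢d c≢d | inj₂ b<a | inj₂ c<a | inj₂ d<a with <-or-> b≢c
  ...   | inj₂ c<b with <-or-> b≢d
  ...     | inj₂ d<b = inj₁ (inj₂ (c<a , c<b , d<a , d<b))
  ...     | inj₁ b<d = inj₂ (inj₂ (inj₂ (c<a , <-trans c<b b<d , b<a , b<d)))
  some-partner _ _ _ b≢c b≢d c≢d | inj₂ b<a | inj₂ c<a | inj₂ d<a | inj₁ b<c with <-or-> c≢d
  ...     | inj₂ d<c = inj₂ (inj₁ (inj₂ (b<a , b<c , d<a , d<c)))
  ...     | inj₁ c<d = inj₂ (inj₂ (inj₂ (c<a , c<d , b<a , <-trans b<c c<d)))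

module FinOrder {n : ℕ} = StrictOrderFacts (Fin.<-isStrictTotalOrder {n})
open FinOrder

private variable
  m n N : ℕ

sum-mono-≤ : {f g : Fin N → ℕ} → (∀ i → f i ≤ g i) → sum f ≤ sum g
sum-mono-≤ {zero}  _   = z≤n
sum-mono-≤ {suc N} f≤g = +-mono-≤ (f≤g zero) (sum-mono-≤ (f≤g ∘ suc))

≤-sum : (f : Fin N → ℕ) (i : Fin N) → f i ≤ sum f
≤-sum f zero    = m≤m+n _ _
≤-sum f (suc i) = ≤-trans (≤-sum (f ∘ suc) i) (m≤n+m _ _)

sum-<⇒∃< : {f g : Fin N → ℕ} → sum f < sum g → ∃ λ i → f i < g i
sum-<⇒∃< {suc N} {f} {g} Σf<Σg with f zero <? g zero
... | yes f₀<g₀ = zero , f₀<g₀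
... | no  f₀≮g₀ with sum-<⇒∃< (+-cancelˡ-< (g zero) _ _ (≤-<-trans (+-monoˡ-≤ _ (≮⇒≥ f₀≮g₀)) Σf<Σg))
...   | i , fᵢ<gᵢ = suc i , fᵢ<gᵢ

𝟙 : {P : Set} → Dec P → ℕ
𝟙 (yes _) = 1
𝟙 (no _)  = 0

1≤𝟙 : {P : Set} (p? : Dec P) → P → 1 ≤ 𝟙 p?
1≤𝟙 (yes _) _ = ≤-refl
1≤𝟙 (no ¬p) p = contradiction p ¬p

𝟙-≤ : {P : Set} (p? : Dec P) {k : ℕ} → (P → 1 ≤ k) → 𝟙 p? ≤ k
𝟙-≤ (yes p) 1≤k = 1≤k p
𝟙-≤ (no _)  _   = z≤n

𝟙*<𝟙*⇒ : {P : Set} (p? : Dec P) {k l : ℕ} → 𝟙 p? * k < 𝟙 p? * l → P × k < l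
𝟙*<𝟙*⇒ (yes p) {k} {l} k<l = p , subst₂ _<_ (*-identityˡ k) (*-identityˡ l) k<l
𝟙*<𝟙*⇒ (no _) ()

positive-summand : ∀ {a b c} → 1 ≤ a ⊎ 1 ≤ b ⊎ 1 ≤ c → 1 ≤ a + (b + c)
positive-summand {a}         (inj₁ 1≤a)        = ≤-trans 1≤a (m≤m+n a _)
positive-summand {a} {b} {c} (inj₂ (inj₁ 1≤b)) = ≤-trans 1≤b (≤-trans (m≤m+n b c) (m≤n+m _ a))
positive-summand {a} {b} {c} (inj₂ (inj₂ 1≤c)) = ≤-trans 1≤c (≤-trans (m≤n+m c b) (m≤n+m _ a))

length-filter-∷ : {A : Set} {P : Pred A 0ℓ} (P? : Decidable P) (x : A) (xs : List A) →
                  length (filter P? (x ∷ xs)) ≡ 𝟙 (P? x) + length (filter P? xs)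
length-filter-∷ P? x xs with P? x
... | yes _ = refl
... | no _  = refl

length-filter-∁ : {A : Set} {P : Pred A 0ℓ} (P? : Decidable P) (xs : List A) →
                  length (filter P? xs) + length (filter (∁? P?) xs) ≡ length xs
length-filter-∁ P? []       = refl
length-filter-∁ P? (x ∷ xs) with P? x
... | yes _ = cong suc (length-filter-∁ P? xs)
... | no  _ = trans (+-suc _ _) (cong suc (length-filter-∁ P? xs))

pairs : {A : Set} → List A → List (A × A)
pairs []       = []
pairs (x ∷ xs) = map (x ,_) xs ++ pairs xs

∈-pairs : {A : Set} {x y : A} {xs : List A} → x ∈ xs → y ∈ xs → x ≢ y →
          (x , y) ∈ pairs xs ⊎ (y , x) ∈ pairs xs
∈-pairs (here refl) (here refl) x≢y = contradiction refl x≢y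
∈-pairs {xs = z ∷ zs} (here refl) (there y∈zs) _ = inj₁ (∈-++⁺ˡ (∈-map⁺ (z ,_) y∈zs))
∈-pairs {xs = z ∷ zs} (there x∈zs) (here refl) _ = inj₂ (∈-++⁺ˡ (∈-map⁺ (z ,_) x∈zs))
∈-pairs {xs = z ∷ zs} (there x∈zs) (there y∈zs) x≢y =
  Sum.map (∈-++⁺ʳ (map (z ,_) zs)) (∈-++⁺ʳ (map (z ,_) zs)) (∈-pairs x∈zs y∈zs x≢y)

length-pairs : {A : Set} (xs : List A) → 2 * length (pairs xs) + length xs ≡ length xs * length xs
length-pairs []       = refl
length-pairs (x ∷ xs) = begin
  2 * length (map (x ,_) xs ++ pairs xs) + suc l ≡⟨ cong (λ k → 2 * k + suc l)
                                                      (trans (length-++ (map (x ,_) xs)) (cong (_+ P) (length-map (x ,_) xs))) ⟩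
  2 * (l + P) + suc l                           ≡⟨ solve 2 (λ l P → con 2 :* (l :+ P) :+ (con 1 :+ l)
                                                                := con 1 :+ (con 2 :* l :+ (con 2 :* P :+ l))) refl l P ⟩
  suc (2 * l + (2 * P + l))                     ≡⟨ cong (λ k → suc (2 * l + k)) (length-pairs xs) ⟩
  suc (2 * l + l * l)                           ≡⟨ solve 1 (λ l → con 1 :+ (con 2 :* l :+ l :* l)
                                                                := (con 1 :+ l) :* (con 1 :+ l)) refl l ⟩
  suc l * suc l                                 ∎
  where
  open ≡-Reasoning
  l P : ℕ
  l = length xs
  P = length (pairs xs)

length-cartesianProductWith : {A B C : Set} (f : A → B → C) (xs : List A) (ys : List B) →
                              length (cartesianProductWith f xs ys) ≡ length xs * length ys
length-cartesianProductWith f []       ys = refl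
length-cartesianProductWith f (x ∷ xs) ys =
  trans (length-++ (map (f x) ys)) (cong₂ _+_ (length-map (f x) ys) (length-cartesianProductWith f xs ys))

module Sampling {G : Pred (Fin N) 0ℓ} (G? : Decidable G) where

  goodSum : (Fin N → ℕ) → ℕ
  goodSum h = sum λ ω → 𝟙 (G? ω) * h ω

  #good : ℕ
  #good = sum (𝟙 ∘ G?)

  goodSum-+ : (f g : Fin N → ℕ) → goodSum (λ ω → f ω + g ω) ≡ goodSum f + goodSum g
  goodSum-+ f g = trans (sum-cong-≗ λ ω → *-distribˡ-+ (𝟙 (G? ω)) (f ω) (g ω))
                        (∑-distrib-+ (λ ω → 𝟙 (G? ω) * f ω) (λ ω → 𝟙 (G? ω) * g ω))

  goodSum-* : (k : ℕ) (f : Fin N → ℕ) → goodSum (λ ω → k * f ω) ≡ k * goodSum f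
  goodSum-* k f = trans (sum-cong-≗ λ ω → x∙yz≈y∙xz (𝟙 (G? ω)) k (f ω))
                        (sym (*-distribˡ-sum k (λ ω → 𝟙 (G? ω) * f ω)))

  module _ {S : Pred (Fin N) 0ℓ} (S? : Decidable S) (ρ₁ ρ₂ : Permutation′ N)
           (G-ρ₁ : ∀ {ω} → G ω → G (ρ₁ ⟨$⟩ʳ ω)) (G-ρ₂ : ∀ {ω} → G ω → G (ρ₂ ⟨$⟩ʳ ω))
           (one-of-three : ∀ {ω} → G ω → S ω ⊎ S (ρ₁ ⟨$⟩ʳ ω) ⊎ S (ρ₂ ⟨$⟩ʳ ω)) where

    private
      h : Fin N → ℕ
      h ω = 𝟙 (G? ω) * 𝟙 (S? ω)

      1≤h : ∀ {ω} → G ω → S ω → 1 ≤ h ω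
      1≤h {ω} g s = *-mono-≤ (1≤𝟙 (G? ω) g) (1≤𝟙 (S? ω) s)

      covered : ∀ ω → 𝟙 (G? ω) ≤ h ω + (h (ρ₁ ⟨$⟩ʳ ω) + h (ρ₂ ⟨$⟩ʳ ω))
      covered ω = 𝟙-≤ (G? ω) λ g →
        positive-summand (Sum.map (1≤h g) (Sum.map (1≤h (G-ρ₁ g)) (1≤h (G-ρ₂ g))) (one-of-three g))

    #good≤3*goodSum : #good ≤ 3 * goodSum (𝟙 ∘ S?)
    #good≤3*goodSum = begin
      #good
        ≤⟨ sum-mono-≤ covered ⟩
      sum (λ ω → h ω + (h (ρ₁ ⟨$⟩ʳ ω) + h (ρ₂ ⟨$⟩ʳ ω)))
        ≡⟨ trans (∑-distrib-+ h _) (cong (sum h +_) (∑-distrib-+ (h ∘ (ρ₁ ⟨$⟩ʳ_)) (h ∘ (ρ₂ ⟨$⟩ʳ_)))) ⟩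
      sum h + (sum (h ∘ (ρ₁ ⟨$⟩ʳ_)) + sum (h ∘ (ρ₂ ⟨$⟩ʳ_)))
        ≡⟨ cong₂ (λ x y → sum h + (x + y)) (sym (sum-permute h ρ₁)) (sym (sum-permute h ρ₂)) ⟩
      sum h + (sum h + sum h)
        ≡⟨ cong (λ x → sum h + (sum h + x)) (sym (+-identityʳ _)) ⟩
      3 * sum h ∎
      where open ≤-Reasoning

  module _ {C : Set} {Sat : Fin N → C → Set} (Sat? : ∀ ω c → Dec (Sat ω c)) (k : ℕ)
           (dense : ∀ c → #good ≤ k * goodSum (λ ω → 𝟙 (Sat? ω c))) where

    satisfied : Fin N → List C → ℕ
    satisfied ω R = length (filter (Sat? ω) R)

    length*#good≤k*goodSum : ∀ R → length R * #good ≤ k * goodSum (λ ω → satisfied ω R)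
    length*#good≤k*goodSum []      = z≤n
    length*#good≤k*goodSum (c ∷ R) = begin
      #good + length R * #good                           ≤⟨ +-mono-≤ (dense c) (length*#good≤k*goodSum R) ⟩
      k * goodSum (λ ω → 𝟙 (Sat? ω c)) + k * goodSum (λ ω → satisfied ω R)
                                                         ≡⟨ sym (*-distribˡ-+ k _ _) ⟩
      k * (goodSum (λ ω → 𝟙 (Sat? ω c)) + goodSum (λ ω → satisfied ω R))
                                                         ≡⟨ cong (k *_) (sym (goodSum-+ _ _)) ⟩
      k * goodSum (λ ω → 𝟙 (Sat? ω c) + satisfied ω R)   ≡⟨ cong (k *_) (sum-cong-≗ λ ω →
                                                              cong (𝟙 (G? ω) *_) (sym (length-filter-∷ (Sat? ω) c R))) ⟩
      k * goodSum (λ ω → satisfied ω (c ∷ R))            ∎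
      where open ≤-Reasoning

    good-point-satisfying-fraction : ∃ G → ∀ R → ∃ λ ω → G ω × length R ≤ k * satisfied ω R
    good-point-satisfying-fraction (ω₀ , g₀) R =
      Product.map₂ (Product.map₂ ≤-pred ∘ 𝟙*<𝟙*⇒ (G? _)) (sum-<⇒∃< average<)
      where
      L : ℕ
      L = length R
      average< : goodSum (const L) < goodSum (λ ω → suc (k * satisfied ω R))
      average< = begin-strict
        goodSum (const L)
          ≡⟨ sum-cong-≗ (λ ω → *-comm (𝟙 (G? ω)) L) ⟩
        sum (λ ω → L * 𝟙 (G? ω))
          ≡⟨ sym (*-distribˡ-sum L (𝟙 ∘ G?)) ⟩
        L * #good
          <⟨ m<n+m _ (≤-trans (1≤𝟙 (G? ω₀) g₀) (≤-sum (𝟙 ∘ G?) ω₀)) ⟩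
        #good + L * #good
          ≤⟨ +-monoʳ-≤ #good (length*#good≤k*goodSum R) ⟩
        #good + k * goodSum (λ ω → satisfied ω R)
          ≡⟨ cong (#good +_) (sym (goodSum-* k _)) ⟩
        #good + goodSum (λ ω → k * satisfied ω R)
          ≡⟨ sym (∑-distrib-+ (𝟙 ∘ G?) (λ ω → 𝟙 (G? ω) * (k * satisfied ω R))) ⟩
        sum (λ ω → 𝟙 (G? ω) + 𝟙 (G? ω) * (k * satisfied ω R))
          ≡⟨ sum-cong-≗ (λ ω → sym (*-suc (𝟙 (G? ω)) _)) ⟩
        goodSum (λ ω → suc (k * satisfied ω R)) ∎
        where open ≤-Reasoning

module GreedyCover {X C : Set} {Good : X → Set} {Sat : X → C → Set} (Sat? : ∀ x c → Dec (Sat x c))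
                   (k : ℕ) (dense : ∀ R → ∃ λ x → Good x × length R ≤ suc k * length (filter (Sat? x) R)) where

  record Cover (R : List C) : Set where
    field
      size   : ℕ
      point  : Fin size → X
      good   : ∀ i → Good (point i)
      covers : ∀ {c} → c ∈ R → ∃ λ i → Sat (point i) c
      -- round q starts with at least one and at most (k/(k+1))^q · |R| unmet requirements
      rounds : ∀ {q} → q < size → suc k ^ q ≤ k ^ q * length R

  unsatisfied-shrinks : ∀ {l s u} → s + u ≡ l → l ≤ suc k * s → suc k * u ≤ k * l
  unsatisfied-shrinks {l} {s} {u} s+u≡l l≤ = +-cancelˡ-≤ l _ _ (begin
    l + suc k * u           ≤⟨ +-monoˡ-≤ _ l≤ ⟩
    suc k * s + suc k * u   ≡⟨ sym (*-distribˡ-+ (suc k) s u) ⟩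
    suc k * (s + u)         ≡⟨ cong (suc k *_) s+u≡l ⟩
    l + k * l               ∎)
    where open ≤-Reasoning

  cover : ∀ R → Acc _<_ (length R) → Cover R
  cover []      _        = record { size = 0 ; point = λ () ; good = λ () ; covers = λ () ; rounds = λ () }
  cover R@(_ ∷ _) (acc rs) with dense R
  ... | x , good-x , many = record
    { size = suc (size rest) ; point = point′ ; good = good′ ; covers = covers′ ; rounds = rounds′ }
    where
    open Cover
    R′ : List C
    R′ = filter (∁? (Sat? x)) R
    shrinks : suc k * length R′ ≤ k * length R
    shrinks = unsatisfied-shrinks (length-filter-∁ (Sat? x) R) many
    rest : Cover R′
    rest = cover R′ (rs (*-cancelˡ-< (suc k) _ _ (≤-<-trans shrinks (m<n+m (k * length R) (s≤s z≤n)))))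
    point′ : Fin (suc (size rest)) → X
    point′ zero    = x
    point′ (suc i) = point rest i
    good′ : ∀ i → Good (point′ i)
    good′ zero    = good-x
    good′ (suc i) = good rest i
    covers′ : ∀ {c} → c ∈ R → ∃ λ i → Sat (point′ i) c
    covers′ {c} c∈R with Sat? x c
    ... | yes s = zero , s
    ... | no ¬s with covers rest (∈-filter⁺ (∁? (Sat? x)) c∈R ¬s)
    ...   | i , s = suc i , s
    rounds′ : ∀ {q} → q < suc (size rest) → suc k ^ q ≤ k ^ q * length R
    rounds′ {zero}  _         = s≤s z≤n
    rounds′ {suc q} (s≤s q<n) = begin
      suc k * suc k ^ q             ≤⟨ *-monoʳ-≤ (suc k) (rounds rest q<n) ⟩
      suc k * (k ^ q * length R′)   ≡⟨ x∙yz≈y∙xz (suc k) (k ^ q) _ ⟩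
      k ^ q * (suc k * length R′)   ≤⟨ *-monoʳ-≤ (k ^ q) shrinks ⟩
      k ^ q * (k * length R)        ≡⟨ x∙yz≈y∙xz (k ^ q) k _ ⟩
      k * (k ^ q * length R)        ≡⟨ sym (*-assoc k _ _) ⟩
      k * k ^ q * length R          ∎
      where open ≤-Reasoning

  greedy-cover : ∀ R → Cover R
  greedy-cover R = cover R (<-wellFounded (length R))

transpose-matchˡ : (i j : Fin n) → transpose i j ⟨$⟩ʳ i ≡ j
transpose-matchˡ i j rewrite dec-true (i Fin.≟ i) refl = refl

transpose-matchʳ : (i j : Fin n) → transpose i j ⟨$⟩ʳ j ≡ i
transpose-matchʳ i j with j Fin.≟ i
... | yes j≡i = j≡i
... | no _ rewrite dec-true (j Fin.≟ j) refl = refl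

transpose-other : {i j k : Fin n} → k ≢ i → k ≢ j → transpose i j ⟨$⟩ʳ k ≡ k
transpose-other {i = i} {j} {k} k≢i k≢j
  rewrite dec-false (k Fin.≟ i) k≢i | dec-false (k Fin.≟ j) k≢j = refl

funToFin-cong : {f g : Fin m → Fin n} → f ≗ g → funToFin f ≡ funToFin g
funToFin-cong {zero}  _   = refl
funToFin-cong {suc m} f≗g = cong₂ combine (f≗g zero) (funToFin-cong (f≗g ∘ suc))

module _ {m n : ℕ} where

  precompose : (Fin m → Fin m) → Fin (n ^ m) → Fin (n ^ m)
  precompose g ω = funToFin (finToFun ω ∘ g)

  finToFun-precompose : (g : Fin m → Fin m) (ω : Fin (n ^ m)) →
                        finToFun (precompose g ω) ≗ finToFun {n} {m} ω ∘ g
  finToFun-precompose g ω = Fin.finToFun-funToFin (finToFun ω ∘ g)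

  precompose-inverse : {g h : Fin m → Fin m} → (∀ i → g (h i) ≡ i) →
                       ∀ ω → precompose h (precompose g ω) ≡ ω
  precompose-inverse {g} {h} gh ω = begin
    funToFin (finToFun (precompose g ω) ∘ h) ≡⟨ funToFin-cong (λ i →
                                                  trans (finToFun-precompose g ω (h i)) (cong (finToFun ω) (gh i))) ⟩
    funToFin (finToFun {n} {m} ω)            ≡⟨ Fin.funToFin-finToFin {m} {n} ω ⟩
    ω                                        ∎
    where open ≡-Reasoning

  reindex : Permutation′ m → Permutation′ (n ^ m)
  reindex σ = permutation (precompose (σ ⟨$⟩ʳ_)) (precompose (σ ⟨$⟩ˡ_))
    (precompose-inverse (λ _ → inverseˡ σ)) (precompose-inverse (λ _ → inverseʳ σ))

injective⇒surjective : {f : Fin n → Fin n} → Injective _≡_ _≡_ f → ∀ y → ∃ λ x → f x ≡ y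
injective⇒surjective {suc n} {f} f-inj y with Fin.any? (λ x → f x Fin.≟ y)
... | yes found = found
... | no ¬found = ⊥-elim (Fin.<⇒notInjective ≤-refl punchOut-inj)
  where
  y≢f : ∀ x → y ≢ f x
  y≢f x y≡fx = ¬found (x , sym y≡fx)
  punchOut-inj : Injective _≡_ _≡_ (λ x → punchOut (y≢f x))
  punchOut-inj eq = f-inj (Fin.punchOut-injective (y≢f _) (y≢f _) eq)

toPermutation : (f : Fin n → Fin n) → Injective _≡_ _≡_ f → Permutation′ n
toPermutation f f-inj = permutation f (proj₁ ∘ surj) (proj₂ ∘ surj) (λ x → f-inj (proj₂ (surj (f x))))
  where
  surj : ∀ y → ∃ λ x → f x ≡ y
  surj = injective⇒surjective f-inj

injective? : (f : Fin m → Fin n) → Dec (Injective _≡_ _≡_ f)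
injective? f = map′ (λ inj {x} {y} → inj x y) (λ inj x y → inj)
  (Fin.all? λ x → Fin.all? λ y → (f x Fin.≟ f y) →-dec (x Fin.≟ y))

data Constraint (n : ℕ) : Set where
  separate : (e f : Fin n × Fin n) → Constraint n
  between  : (v : Fin n) (uw : Fin n × Fin n) → Constraint n

Relevant : Constraint n → Set
Relevant (separate (a , b) (c , d)) = Disjoint a b c d
Relevant (between v (u , w))        = u ≢ v × w ≢ v × u ≢ w

Holds : (Fin n → Fin n) → Constraint n → Set
Holds p (separate (a , b) (c , d)) = Separated₄ (p a) (p b) (p c) (p d)
Holds p (between v (u , w))        = Between₃ (p u) (p v) (p w)

Sat : (Fin n → Fin n) → Constraint n → Set
Sat p c = Relevant c → Holds p c

relevant? : (c : Constraint n) → Dec (Relevant c)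
relevant? (separate (a , b) (c , d)) =
  ¬? (a Fin.≟ c) ×-dec ¬? (a Fin.≟ d) ×-dec ¬? (b Fin.≟ c) ×-dec ¬? (b Fin.≟ d)
relevant? (between v (u , w)) = ¬? (u Fin.≟ v) ×-dec ¬? (w Fin.≟ v) ×-dec ¬? (u Fin.≟ w)

holds? : (p : Fin n → Fin n) (c : Constraint n) → Dec (Holds p c)
holds? p (separate (a , b) (c , d)) = Separated₄? (p a) (p b) (p c) (p d)
holds? p (between v (u , w))        = Between₃? (p u) (p v) (p w)

sat? : (p : Fin n → Fin n) (c : Constraint n) → Dec (Sat p c)
sat? p c = relevant? c →-dec holds? p c

Holds-resp-≗ : {p q : Fin n → Fin n} → p ≗ q → ∀ c → Holds p c → Holds q c
Holds-resp-≗ p≗q (separate (a , b) (c , d)) rewrite p≗q a | p≗q b | p≗q c | p≗q d = λ h → h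
Holds-resp-≗ p≗q (between v (u , w))        rewrite p≗q u | p≗q v | p≗q w = λ h → h

relabel : Permutation′ n → Constraint n → Constraint n
relabel σ (separate (a , b) (c , d)) = separate (σ ⟨$⟩ʳ a , σ ⟨$⟩ʳ b) (σ ⟨$⟩ʳ c , σ ⟨$⟩ʳ d)
relabel σ (between v (u , w))        = between (σ ⟨$⟩ʳ v) (σ ⟨$⟩ʳ u , σ ⟨$⟩ʳ w)

Holds-relabel : (p : Fin n → Fin n) (σ : Permutation′ n) (c : Constraint n) →
                Holds p (relabel σ c) → Holds (p ∘ (σ ⟨$⟩ʳ_)) c
Holds-relabel p σ (separate (a , b) (c , d)) h = h
Holds-relabel p σ (between v (u , w))        h = h

Orbit : Constraint n → Set
Orbit {n} c = ∃₂ λ (σ τ : Permutation′ n) → ∀ p → Injective _≡_ _≡_ p →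
  Holds p c ⊎ Holds p (relabel σ c) ⊎ Holds p (relabel τ c)

between-orbit : {u v w : Fin n} → u ≢ v → w ≢ v → u ≢ w → Orbit (between v (u , w))
between-orbit {u = u} {v} {w} u≢v w≢v u≢w = transpose v u , transpose v w , λ p p-inj →
  Sum.map₂ (Sum.map (subst (Holds p) (sym v↔u)) (subst (Holds p) (sym v↔w)))
    (some-between (contraInjective p-inj u≢v) (contraInjective p-inj (w≢v ∘ sym)) (contraInjective p-inj u≢w))
  where
  v↔u : relabel (transpose v u) (between v (u , w)) ≡ between u (v , w)
  v↔u = cong₂ between (transpose-matchˡ v u) (cong₂ _,_ (transpose-matchʳ v u) (transpose-other w≢v (u≢w ∘ sym)))
  v↔w : relabel (transpose v w) (between v (u , w)) ≡ between w (u , v)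
  v↔w = cong₂ between (transpose-matchˡ v w) (cong₂ _,_ (transpose-other u≢v u≢w) (transpose-matchʳ v w))

loop-edge-orbit : {a c d : Fin n} → a ≢ c → a ≢ d → c ≢ d → Orbit (separate (a , a) (c , d))
loop-edge-orbit {a = a} {c} {d} a≢c a≢d c≢d = transpose a c , transpose a d , λ p p-inj →
  Sum.map₂ (Sum.map (subst (Holds p) (sym a↔c)) (subst (Holds p) (sym a↔d)))
    (some-extreme (contraInjective p-inj a≢c) (contraInjective p-inj a≢d) (contraInjective p-inj c≢d))
  where
  a↔c : relabel (transpose a c) (separate (a , a) (c , d)) ≡ separate (c , c) (a , d)
  a↔c = cong₂ separate (cong₂ _,_ (transpose-matchˡ a c) (transpose-matchˡ a c))
                       (cong₂ _,_ (transpose-matchʳ a c) (transpose-other (a≢d ∘ sym) (c≢d ∘ sym)))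
  a↔d : relabel (transpose a d) (separate (a , a) (c , d)) ≡ separate (d , d) (c , a)
  a↔d = cong₂ separate (cong₂ _,_ (transpose-matchˡ a d) (transpose-matchˡ a d))
                       (cong₂ _,_ (transpose-other (a≢c ∘ sym) c≢d) (transpose-matchʳ a d))

edge-loop-orbit : {a b c : Fin n} → a ≢ b → a ≢ c → b ≢ c → Orbit (separate (a , b) (c , c))
edge-loop-orbit {a = a} {b} {c} a≢b a≢c b≢c = transpose c a , transpose c b , λ p p-inj →
  Sum.map Separated₄-sym (Sum.map (subst (Holds p) (sym c↔a) ∘ Separated₄-sym)
                                  (subst (Holds p) (sym c↔b) ∘ Separated₄-sym))
    (some-extreme (contraInjective p-inj (a≢c ∘ sym)) (contraInjective p-inj (b≢c ∘ sym)) (contraInjective p-inj a≢b))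
  where
  c↔a : relabel (transpose c a) (separate (a , b) (c , c)) ≡ separate (c , b) (a , a)
  c↔a = cong₂ separate (cong₂ _,_ (transpose-matchʳ c a) (transpose-other b≢c (a≢b ∘ sym)))
                       (cong₂ _,_ (transpose-matchˡ c a) (transpose-matchˡ c a))
  c↔b : relabel (transpose c b) (separate (a , b) (c , c)) ≡ separate (a , c) (b , b)
  c↔b = cong₂ separate (cong₂ _,_ (transpose-other a≢c a≢b) (transpose-matchʳ c b))
                       (cong₂ _,_ (transpose-matchˡ c b) (transpose-matchˡ c b))

edge-edge-orbit : {a b c d : Fin n} → a ≢ b → a ≢ c → a ≢ d → b ≢ c → b ≢ d → c ≢ d →
                  Orbit (separate (a , b) (c , d))
edge-edge-orbit {a = a} {b} {c} {d} a≢b a≢c a≢d b≢c b≢d c≢d = transpose b c , transpose b d , λ p p-inj →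
  Sum.map₂ (Sum.map (subst (Holds p) (sym b↔c)) (subst (Holds p) (sym b↔d)))
    (some-partner (contraInjective p-inj a≢b) (contraInjective p-inj a≢c) (contraInjective p-inj a≢d)
                  (contraInjective p-inj b≢c) (contraInjective p-inj b≢d) (contraInjective p-inj c≢d))
  where
  b↔c : relabel (transpose b c) (separate (a , b) (c , d)) ≡ separate (a , c) (b , d)
  b↔c = cong₂ separate (cong₂ _,_ (transpose-other a≢b a≢c) (transpose-matchˡ b c))
                       (cong₂ _,_ (transpose-matchʳ b c) (transpose-other (b≢d ∘ sym) (c≢d ∘ sym)))
  b↔d : relabel (transpose b d) (separate (a , b) (c , d)) ≡ separate (a , d) (c , b)
  b↔d = cong₂ separate (cong₂ _,_ (transpose-other a≢b a≢d) (transpose-matchˡ b d))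
                       (cong₂ _,_ (transpose-other (b≢c ∘ sym) c≢d) (transpose-matchʳ b d))

orbit : (c : Constraint n) → Relevant c → Orbit c
orbit (between v (u , w)) (u≢v , w≢v , u≢w) = between-orbit u≢v w≢v u≢w
orbit (separate (a , b) (c , d)) (a≢c , a≢d , b≢c , b≢d) with a Fin.≟ b | c Fin.≟ d
... | yes refl | yes refl = id , id , λ p p-inj → inj₁ (points-separated (contraInjective p-inj a≢c))
... | yes refl | no c≢d   = loop-edge-orbit a≢c a≢d c≢d
... | no a≢b   | yes refl = edge-loop-orbit a≢b a≢c b≢c
... | no a≢b   | no c≢d   = edge-edge-orbit a≢b a≢c a≢d b≢c b≢d c≢d

module Orders (n : ℕ) where

  positions : Fin (n ^ n) → Fin n → Fin n
  positions = finToFun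

  IsOrder : Pred (Fin (n ^ n)) 0ℓ
  IsOrder ω = Injective _≡_ _≡_ (positions ω)

  open Sampling (injective? ∘ positions)

  IsOrder-reindex : (σ : Permutation′ n) → ∀ {ω} → IsOrder ω → IsOrder (reindex σ ⟨$⟩ʳ ω)
  IsOrder-reindex σ {ω} ω-inj {x} {y} eq = begin
    x                       ≡⟨ inverseˡ σ ⟨
    σ ⟨$⟩ˡ (σ ⟨$⟩ʳ x)        ≡⟨ cong (σ ⟨$⟩ˡ_) (ω-inj (trans (sym (finToFun-precompose (σ ⟨$⟩ʳ_) ω x))
                                                          (trans eq (finToFun-precompose (σ ⟨$⟩ʳ_) ω y)))) ⟩
    σ ⟨$⟩ˡ (σ ⟨$⟩ʳ y)        ≡⟨ inverseˡ σ ⟩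
    y                       ∎
    where open ≡-Reasoning

  sat-reindex : (σ : Permutation′ n) (c : Constraint n) {ω : Fin (n ^ n)} →
                Holds (positions ω) (relabel σ c) → Sat (positions (reindex σ ⟨$⟩ʳ ω)) c
  sat-reindex σ c {ω} h _ =
    Holds-resp-≗ (sym ∘ finToFun-precompose (σ ⟨$⟩ʳ_) ω) c (Holds-relabel (positions ω) σ c h)

  #good≤3*#satisfying : (c : Constraint n) → #good ≤ 3 * goodSum (λ ω → 𝟙 (sat? (positions ω) c))
  #good≤3*#satisfying c = by-relevance (relevant? c)
    where
    S? : Decidable (λ ω → Sat (positions ω) c)
    S? ω = sat? (positions ω) c
    by-relevance : Dec (Relevant c) → #good ≤ 3 * goodSum (𝟙 ∘ S?)
    by-relevance (no ¬r) =
      #good≤3*goodSum S? id id (λ g → g) (λ g → g) (λ _ → inj₁ (λ r → contradiction r ¬r))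
    by-relevance (yes r) with orbit c r
    ... | σ , τ , holds = #good≤3*goodSum S? (reindex σ) (reindex τ) (IsOrder-reindex σ) (IsOrder-reindex τ)
      (λ {ω} ω-inj → Sum.map const (Sum.map (sat-reindex σ c) (sat-reindex τ c)) (holds (positions ω) ω-inj))

  identity-order : ∃ IsOrder
  identity-order = funToFin {n} {n} (λ i → i) , λ {x} {y} eq →
    trans (sym (Fin.finToFun-funToFin (λ i → i) x)) (trans eq (Fin.finToFun-funToFin (λ i → i) y))

  open GreedyCover (λ ω → sat? (positions ω)) 2
    (good-point-satisfying-fraction (λ ω → sat? (positions ω)) 3 #good≤3*#satisfying identity-order) public

constraints : ∀ n → List (Constraint n)
constraints n = map (uncurry separate) (pairs (cartesianProduct vs vs)) ++ cartesianProductWith between vs (pairs vs)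
  where
  vs : List (Fin n)
  vs = allFin n

3n≤n²+6 : ∀ n → 3 * n ≤ n * n + 6
3n≤n²+6 n with n ≤? 2
... | yes n≤2 = ≤-trans (*-monoʳ-≤ 3 n≤2) (m≤n+m 6 (n * n))
... | no  n≰2 = ≤-trans (*-monoˡ-≤ n (≰⇒> n≰2)) (m≤m+n (n * n) 6)

3[P+nQ]≤2n⁴ : ∀ {n P Q} → 2 * P + n * n ≡ (n * n) * (n * n) → 2 * Q + n ≡ n * n →
              3 * (P + n * Q) ≤ 2 * n ^ 4
3[P+nQ]≤2n⁴ {n} {P} {Q} hP hQ = *-cancelˡ-≤ 2 (+-cancelʳ-≤ (6 * (n * n)) _ _ (begin
  2 * (3 * (P + n * Q)) + 6 * (n * n)
    ≡⟨ solve 3 (λ n P Q → con 2 :* (con 3 :* (P :+ n :* Q)) :+ con 6 :* (n :* n)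
                       := con 3 :* (con 2 :* P :+ n :* n) :+ con 3 :* n :* (con 2 :* Q :+ n)) refl n P Q ⟩
  3 * (2 * P + n * n) + 3 * n * (2 * Q + n)
    ≡⟨ cong₂ (λ x y → 3 * x + 3 * n * y) hP hQ ⟩
  3 * ((n * n) * (n * n)) + 3 * n * (n * n)
    ≡⟨ cong (3 * ((n * n) * (n * n)) +_) (*-comm (3 * n) (n * n)) ⟩
  3 * ((n * n) * (n * n)) + (n * n) * (3 * n)
    ≤⟨ +-monoʳ-≤ _ (*-monoʳ-≤ (n * n) (3n≤n²+6 n)) ⟩
  3 * ((n * n) * (n * n)) + (n * n) * (n * n + 6)
    ≡⟨ solve 1 (λ n → con 3 :* ((n :* n) :* (n :* n)) :+ (n :* n) :* (n :* n :+ con 6)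
                   := con 2 :* (con 2 :* n :^ 4) :+ con 6 :* (n :* n)) refl n ⟩
  2 * (2 * n ^ 4) + 6 * (n * n) ∎))
  where open ≤-Reasoning

3*length-constraints≤2n⁴ : ∀ n → 3 * length (constraints n) ≤ 2 * n ^ 4
3*length-constraints≤2n⁴ n = subst (λ l → 3 * l ≤ 2 * n ^ 4) (sym length-constraints)
  (3[P+nQ]≤2n⁴ {n} {length (pairs E)} {length (pairs vs)} hE hV)
  where
  vs : List (Fin n)
  vs = allFin n
  E : List (Fin n × Fin n)
  E = cartesianProduct vs vs
  |vs| : length vs ≡ n
  |vs| = length-tabulate (λ i → i)
  hV : 2 * length (pairs vs) + n ≡ n * n
  hV = subst (λ l → 2 * length (pairs vs) + l ≡ l * l) |vs| (length-pairs vs)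
  hE : 2 * length (pairs E) + n * n ≡ (n * n) * (n * n)
  hE = subst (λ l → 2 * length (pairs E) + l ≡ l * l)
             (trans (length-cartesianProductWith _,_ vs vs) (cong₂ _*_ |vs| |vs|)) (length-pairs E)
  length-constraints : length (constraints n) ≡ length (pairs E) + n * length (pairs vs)
  length-constraints = trans (length-++ (map (uncurry separate) (pairs E)))
    (cong₂ _+_ (length-map (uncurry separate) (pairs E))
               (trans (length-cartesianProductWith between vs (pairs vs)) (cong (_* length (pairs vs)) |vs|)))

between-listed : ∀ v {uw} → uw ∈ pairs (allFin n) → between v uw ∈ constraints n
between-listed v uw∈ = ∈-++⁺ʳ (map (uncurry separate) _) (∈-cartesianProductWith⁺ between (∈-allFin v) uw∈)

module _ {k : ℕ} (pos : Fin k → Fin n → Fin n)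
         (covers : ∀ {c} → c ∈ constraints n → ∃ λ i → Sat (pos i) c) where

  separated-somewhere : ∀ a b c d → Disjoint a b c d →
                        ∃ λ i → Separated₄ (pos i a) (pos i b) (pos i c) (pos i d)
  separated-somewhere a b c d dj@(a≢c , a≢d , b≢c , b≢d)
    with ∈-pairs (∈-cartesianProduct⁺ (∈-allFin a) (∈-allFin b)) (∈-cartesianProduct⁺ (∈-allFin c) (∈-allFin d))
                 (a≢c ∘ cong proj₁)
  ... | inj₁ ab,cd = Product.map₂ (λ s → s dj) (covers (∈-++⁺ˡ (∈-map⁺ (uncurry separate) ab,cd)))
  ... | inj₂ cd,ab = Product.map₂ (λ s → Separated₄-sym (s (a≢c ∘ sym , b≢c ∘ sym , a≢d ∘ sym , b≢d ∘ sym)))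
                                  (covers (∈-++⁺ˡ (∈-map⁺ (uncurry separate) cd,ab)))

  between-somewhere : ∀ v u w → u ≢ v → w ≢ v → u ≢ w →
                      ∃ λ i → Between₃ (pos i u) (pos i v) (pos i w)
  between-somewhere v u w u≢v w≢v u≢w with ∈-pairs (∈-allFin u) (∈-allFin w) u≢w
  ... | inj₁ uw = Product.map₂ (λ s → s (u≢v , w≢v , u≢w)) (covers (between-listed v uw))
  ... | inj₂ wu = Product.map₂ (λ s → Between₃-sym (s (w≢v , u≢v , u≢w ∘ sym))) (covers (between-listed v wu))

4*eNum≤11*! : ∀ k → 4 * eNum k ≤ 11 * k !
4*eNum≤11*! 0             = ≤ᵇ⇒≤ 4 11 _
4*eNum≤11*! 1             = ≤ᵇ⇒≤ 8 11 _
4*eNum≤11*! (suc (suc k)) = ≤-trans (m≤m+n _ 2) (tail k)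
  where
  -- the slack 2 absorbs the + 1 of eNum (k + 1) = (k + 1) * eNum k + 1
  tail : ∀ k → 4 * eNum (2 + k) + 2 ≤ 11 * (2 + k) !
  tail zero    = ≤-refl
  tail (suc k) = begin
    4 * eNum (3 + k) + 2                       ≡⟨ solve 2 (λ m e → con 4 :* (m :* e :+ con 1) :+ con 2
                                                              := m :* (con 4 :* e) :+ con 6) refl (3 + k) (eNum (2 + k)) ⟩
    (3 + k) * (4 * eNum (2 + k)) + 6           ≤⟨ +-monoʳ-≤ _ (m≤m+n 6 (2 * k)) ⟩
    (3 + k) * (4 * eNum (2 + k)) + (6 + 2 * k) ≡⟨ solve 2 (λ k e → (con 3 :+ k) :* (con 4 :* e) :+ (con 6 :+ con 2 :* k)
                                                              := (con 3 :+ k) :* (con 4 :* e :+ con 2)) refl k (eNum (2 + k)) ⟩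
    (3 + k) * (4 * eNum (2 + k) + 2)           ≤⟨ *-monoʳ-≤ (3 + k) (tail k) ⟩
    (3 + k) * (11 * (2 + k) !)                 ≡⟨ x∙yz≈y∙xz (3 + k) 11 ((2 + k) !) ⟩
    11 * (3 + k) !                             ∎
    where open ≤-Reasoning

^-distribʳ-* : ∀ m n o → (m * n) ^ o ≡ m ^ o * n ^ o
^-distribʳ-* m n zero    = refl
^-distribʳ-* m n (suc o) = trans (cong ((m * n) *_) (^-distribʳ-* m n o)) (interchange m n (m ^ o) (n ^ o))

^-swap : ∀ m a b → (m ^ a) ^ b ≡ (m ^ b) ^ a
^-swap m a b = trans (^-*-assoc m a b) (trans (cong (m ^_) (*-comm a b)) (sym (^-*-assoc m b a)))

^-cancelˡ-≤ : ∀ o .{{_ : NonZero o}} {m n} → m ^ o ≤ n ^ o → m ≤ n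
^-cancelˡ-≤ o mᵒ≤nᵒ = ≮⇒≥ λ n<m → <⇒≱ (^-monoˡ-< o n<m) mᵒ≤nᵒ

32e²≤243f² : ∀ {e f} → 4 * e ≤ 11 * f → 32 * e ^ 2 ≤ 243 * f ^ 2
32e²≤243f² {e} {f} 4e≤11f = begin
  32 * e ^ 2         ≡⟨ solve 1 (λ e → con 32 :* e :^ 2 := con 2 :* (con 4 :* e) :^ 2) refl e ⟩
  2 * (4 * e) ^ 2    ≤⟨ *-monoʳ-≤ 2 (^-monoˡ-≤ 2 4e≤11f) ⟩
  2 * (11 * f) ^ 2   ≡⟨ solve 1 (λ f → con 2 :* (con 11 :* f) :^ 2 := con 242 :* f :^ 2) refl f ⟩
  242 * f ^ 2        ≤⟨ *-monoˡ-≤ (f ^ 2) (n≤1+n 242) ⟩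
  243 * f ^ 2        ∎
  where open ≤-Reasoning

logBound : ∀ {p n} → 3 ^ p ≤ 2 ^ p * n ^ 4 → LogBound p n
logBound {p} {n} 3ᵖ≤2ᵖn⁴ k = ^-cancelˡ-≤ 2 (*-cancelˡ-≤ ((2 ^ p) ^ 5) {{m^n≢0 (2 ^ p) 5 {{m^n≢0 2 p}}}} (begin
  (2 ^ p) ^ 5 * (e ^ p) ^ 2                 ≡⟨ cong₂ _*_ (^-swap 2 p 5) (^-swap e p 2) ⟩
  32 ^ p * (e ^ 2) ^ p                      ≡⟨ sym (^-distribʳ-* 32 (e ^ 2) p) ⟩
  (32 * e ^ 2) ^ p                          ≤⟨ ^-monoˡ-≤ p (32e²≤243f² {e} {f} (4*eNum≤11*! k)) ⟩
  (243 * f ^ 2) ^ p                         ≡⟨ ^-distribʳ-* 243 (f ^ 2) p ⟩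
  243 ^ p * (f ^ 2) ^ p                     ≡⟨ cong₂ _*_ (^-swap 3 5 p) (^-swap f 2 p) ⟩
  (3 ^ p) ^ 5 * (f ^ p) ^ 2                 ≤⟨ *-monoˡ-≤ ((f ^ p) ^ 2) (^-monoˡ-≤ 5 3ᵖ≤2ᵖn⁴) ⟩
  (2 ^ p * n ^ 4) ^ 5 * (f ^ p) ^ 2         ≡⟨ cong (_* (f ^ p) ^ 2) (^-distribʳ-* (2 ^ p) (n ^ 4) 5) ⟩
  (2 ^ p) ^ 5 * (n ^ 4) ^ 5 * (f ^ p) ^ 2   ≡⟨ *-assoc ((2 ^ p) ^ 5) ((n ^ 4) ^ 5) ((f ^ p) ^ 2) ⟩
  (2 ^ p) ^ 5 * ((n ^ 4) ^ 5 * (f ^ p) ^ 2) ≡⟨ cong (λ x → (2 ^ p) ^ 5 * (x * (f ^ p) ^ 2))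
                                                   (trans (^-*-assoc n 4 5) (sym (^-*-assoc n 10 2))) ⟩
  (2 ^ p) ^ 5 * ((n ^ 10) ^ 2 * (f ^ p) ^ 2) ≡⟨ cong ((2 ^ p) ^ 5 *_) (sym (^-distribʳ-* (n ^ 10) (f ^ p) 2)) ⟩
  (2 ^ p) ^ 5 * (n ^ 10 * f ^ p) ^ 2        ∎))
  where
  open ≤-Reasoning
  e f : ℕ
  e = eNum k
  f = k !

rounds⇒3ᵖ≤2ᵖn⁴ : ∀ {p l n} → 1 ≤ n → 3 * l ≤ 2 * n ^ 4 → (∀ {q} → q < p → 3 ^ q ≤ 2 ^ q * l) →
                 3 ^ p ≤ 2 ^ p * n ^ 4
rounds⇒3ᵖ≤2ᵖn⁴ {zero}          1≤n _   _      = ≤-trans (^-monoˡ-≤ 4 1≤n) (≤-reflexive (sym (*-identityˡ _)))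
rounds⇒3ᵖ≤2ᵖn⁴ {suc q} {l} {n} _   3l≤ rounds = begin
  3 * 3 ^ q          ≤⟨ *-monoʳ-≤ 3 (rounds ≤-refl) ⟩
  3 * (2 ^ q * l)    ≡⟨ x∙yz≈y∙xz 3 (2 ^ q) l ⟩
  2 ^ q * (3 * l)    ≤⟨ *-monoʳ-≤ (2 ^ q) 3l≤ ⟩
  2 ^ q * (2 * n ^ 4) ≡⟨ x∙yz≈y∙xz (2 ^ q) 2 (n ^ 4) ⟩
  2 * (2 ^ q * n ^ 4) ≡⟨ *-assoc 2 (2 ^ q) (n ^ 4) ⟨
  2 * 2 ^ q * n ^ 4  ∎
  where open ≤-Reasoning

lemma6 : (n : ℕ) → 1 ≤ n →
    ∃[ p ] (LogBound p n ×
      Σ (Fin p → LinOrd n) λ ord →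
        ((a b c d : Fin n) → Disjoint a b c d → ∃[ i ] Separated (ord i) a b c d)
        × ((v u w : Fin n) → u ≢ v → w ≢ v → u ≢ w → ∃[ i ] Between (ord i) u v w))
lemma6 n 1≤n =
  size , logBound {size} {n} (rounds⇒3ᵖ≤2ᵖn⁴ 1≤n (3*length-constraints≤2n⁴ n) rounds) , ord ,
  separated-somewhere pos covers , between-somewhere pos covers
  where
  open Orders n
  open Cover (greedy-cover (constraints n))
  pos : Fin size → Fin n → Fin n
  pos = positions ∘ point
  ord : Fin size → LinOrd n
  ord i = toPermutation (pos i) (good i)
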